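{- Let $(r_1,r_2,r_3)$ be pairwise coprime positive integers with $r_1<r_2<r_3$, and let $\sigma_1=r_1+r_2+r_3$, $\sigma_2=r_1r_2+r_1r_3+r_2r_3$, $\sigma_3=r_1r_2r_3$. Then $\sigma_2$ is invertible modulo $\sigma_3$, so there is a unique integer $\ell$ with $0\le\ell<\sigma_3$ and $\ell\sigma_2\equiv-\sigma_1\pmod{\sigma_3}$. Moreover, $\ell=0$ if and only if $(r_1,r_2,r_3)=(1,2,3)$. -}

module Defs where

open import Data.Nat using (ℕ)
open import Data.Integer using (ℤ; +_; _+_; _*_; -_; _-_)
open import Data.Integer.Divisibility using (_∣_)

σ₁ : ℕ → ℕ → ℕ → ℤ
σ₁ r₁ r₂ r₃ = + r₁ + + r₂ + + r₃

σ₂ : ℕ → ℕ → ℕ → ℤ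
σ₂ r₁ r₂ r₃ = + r₁ * + r₂ + + r₁ * + r₃ + + r₂ * + r₃

σ₃ : ℕ → ℕ → ℕ → ℤ
σ₃ r₁ r₂ r₃ = + r₁ * + r₂ * + r₃

infix 4 _≡_[mod_]
_≡_[mod_] : ℤ → ℤ → ℤ → Set
a ≡ b [mod m ] = m ∣ (a - b)

{-# OPTIONS --safe #-}
-- The three rᵢ are pairwise coprime and σ₂ ≡ rⱼ rₖ (mod rᵢ), so σ₂ is coprime to σ₃ and has an
-- inverse u modulo σ₃ (Bézout); the least non-negative residue of -σ₁ u is then the unique ℓ.
-- It is 0 exactly when σ₃ ∣ σ₁.  As σ₁ < 3 r₃, this forces r₁ r₂ < 3, i.e. (r₁, r₂) = (1, 2),
-- and then 2 r₃ ≤ 3 + r₃ leaves only r₃ = 3.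
module Submission where

open import Defs
open import Data.Nat using (ℕ; _<_)
open import Data.Nat.Coprimality using (Coprime)
open import Data.Integer using (ℤ; +_; _*_; -_; _≤_) renaming (_<_ to _<ℤ_)
open import Data.Product using (_×_; ∃-syntax; _,_)
open import Relation.Binary.PropositionalEquality using (_≡_)
open import Function.Bundles using (_⇔_)

open import Data.Nat as ℕ using (zero; suc; z≤n; s≤s; NonZero)
open import Data.Nat.Properties as ℕ using (module ≤-Reasoning)
open import Data.Nat.Divisibility as ℕ using (_∣_; ∣-trans; ∣m+n∣m⇒∣n; m∣m*n; ∣⇒≤; >⇒∤)
open import Data.Nat.Coprimality as Coprime using (coprime-divisor; coprime-Bézout)
open import Data.Nat.GCD using (module Bézout)
open import Data.Nat.Tactic.RingSolver as ℕ-Ring using ()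
open import Data.Integer as ℤ using (_+_; _-_; _⊖_; ∣_∣; +≤+; +<+)
open import Data.Integer.Properties as ℤ using ()
open import Data.Integer.Divisibility as ℤ using ()
import Data.Integer.Divisibility.Signed as Signed
open import Data.Integer.DivMod using (_%ℕ_; _/ℕ_; n%ℕd<d; a≡a%ℕn+[a/ℕn]*n)
open import Data.Integer.Tactic.RingSolver as ℤ-Ring using ()
open import Data.Sum using (inj₁; inj₂)
open import Relation.Nullary using (contradiction)
open import Relation.Binary.PropositionalEquality using (refl; sym; trans; cong; cong₂; subst; module ≡-Reasoning)
open import Relation.Binary.Bundles using (Setoid)
import Relation.Binary.Reasoning.Setoid as SetoidReasoning
open import Function.Bundles using (mk⇔)
open import Function.Properties.Equivalence using () renaming (trans to ⇔-trans)

variable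
  a b c x y m : ℤ

-- _≡_[mod_] unfolds to absolute values, from which Agda cannot infer a, b and m;
-- the record type is injective in them, so it supports implicit arguments and setoid reasoning.
record _≈_[mod_] (a b m : ℤ) : Set where
  constructor ≈-mod
  field ≡-mod : a ≡ b [mod m ]

open _≈_[mod_] public

infix 4 _≈_[mod_]

signed∣⇒≈-mod : m Signed.∣ (a - b) → a ≈ b [mod m ]
signed∣⇒≈-mod m∣a-b = ≈-mod (Signed.∣⇒∣ᵤ m∣a-b)

≈-mod⇒signed∣ : a ≈ b [mod m ] → m Signed.∣ (a - b)
≈-mod⇒signed∣ {a} {b} {m} (≈-mod a≡b) = Signed.∣ᵤ⇒∣ {m} {a - b} a≡b

≈-mod-reflexive : a ≡ b → a ≈ b [mod m ]
≈-mod-reflexive {a} {m = m} refl =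
  ≈-mod (subst (m ℤ.∣_) (sym (ℤ.+-inverseʳ a)) (∣ m ∣ ℕ.∣0))

≈-mod-sym : a ≈ b [mod m ] → b ≈ a [mod m ]
≈-mod-sym {a} {b} {m} (≈-mod a≡b) = ≈-mod (subst (∣ m ∣ ℕ.∣_) (ℤ.∣i-j∣≡∣j-i∣ a b) a≡b)

≈-mod-trans : a ≈ b [mod m ] → b ≈ c [mod m ] → a ≈ c [mod m ]
≈-mod-trans {a} {b} {m} {c} a≈b b≈c = signed∣⇒≈-mod (subst (m Signed.∣_) (split a b c)
  (Signed.∣m∣n⇒∣m+n (≈-mod⇒signed∣ a≈b) (≈-mod⇒signed∣ b≈c)))
  where
  split : ∀ a b c → (a - b) + (b - c) ≡ a - c
  split = ℤ-Ring.solve-∀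

≈-mod-setoid : ℤ → Setoid _ _
≈-mod-setoid m = record
  { Carrier = ℤ
  ; _≈_ = _≈_[mod m ]
  ; isEquivalence = record
    { refl = ≈-mod-reflexive refl ; sym = ≈-mod-sym ; trans = ≈-mod-trans }
  }

*-congʳ-mod : ∀ c → a ≈ b [mod m ] → a * c ≈ b * c [mod m ]
*-congʳ-mod {a} {b} {m} c a≈b = signed∣⇒≈-mod (subst (m Signed.∣_) (distrib a b c)
  (Signed.∣m⇒∣m*n c (≈-mod⇒signed∣ a≈b)))
  where
  distrib : ∀ a b c → (a - b) * c ≡ a * c - b * c
  distrib = ℤ-Ring.solve-∀

*-congˡ-mod : ∀ c → a ≈ b [mod m ] → c * a ≈ c * b [mod m ]
*-congˡ-mod {a} {b} {m} c a≈b
  rewrite ℤ.*-comm c a | ℤ.*-comm c b = *-congʳ-mod c a≈b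

+-multiple-mod : ∀ a k m → a + k * m ≈ a [mod m ]
+-multiple-mod a k m = signed∣⇒≈-mod (Signed.divides k (cancel a (k * m)))
  where
  cancel : ∀ a x → (a + x) - a ≡ x
  cancel = ℤ-Ring.solve-∀

0≡-b[mod]⇔∣ : ∀ b m → + 0 ≡ - b [mod m ] ⇔ m ℤ.∣ b
0≡-b[mod]⇔∣ b m = mk⇔ (subst (m ℤ.∣_) 0--b≡b) (subst (m ℤ.∣_) (sym 0--b≡b))
  where
  0--b≡b : + 0 - - b ≡ b
  0--b≡b = trans (ℤ.+-identityˡ (- - b)) (ℤ.neg-involutive b)

1+*≡*⇒ℤ : ∀ x y p q → 1 ℕ.+ y ℕ.* q ≡ x ℕ.* p → + 1 + + y * + q ≡ + x * + p
1+*≡*⇒ℤ x y p q eq = begin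
  + 1 + + y * + q       ≡⟨ cong (λ z → + 1 + z) (ℤ.pos-* y q) ⟨
  + 1 + + (y ℕ.* q)     ≡⟨ ℤ.pos-+ 1 (y ℕ.* q) ⟨
  + (1 ℕ.+ y ℕ.* q)     ≡⟨ cong +_ eq ⟩
  + (x ℕ.* p)           ≡⟨ ℤ.pos-* x p ⟩
  + x * + p             ∎
  where open ≡-Reasoning

coprime⇒invertible : ∀ {a n} → Coprime a n → ∃[ u ] (u * + a ≈ + 1 [mod + n ])
coprime⇒invertible {a} {n} a⊥n with coprime-Bézout a⊥n
... | Bézout.+- x y 1+yn≡xa = + x , (begin
  + x * + a          ≡⟨ 1+*≡*⇒ℤ x y a n 1+yn≡xa ⟨
  + 1 + + y * + n    ≈⟨ +-multiple-mod (+ 1) (+ y) (+ n) ⟩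
  + 1                ∎)
  where open SetoidReasoning (≈-mod-setoid (+ n))
... | Bézout.-+ x y 1+xa≡yn = - + x , (begin
  - + x * + a              ≡⟨ negate (+ x) (+ a) ⟩
  + 1 - (+ 1 + + x * + a)  ≡⟨ cong (λ z → + 1 - z) (1+*≡*⇒ℤ y x n a 1+xa≡yn) ⟩
  + 1 - + y * + n          ≡⟨ cong (λ z → + 1 + z) (ℤ.neg-distribˡ-* (+ y) (+ n)) ⟩
  + 1 + - + y * + n        ≈⟨ +-multiple-mod (+ 1) (- + y) (+ n) ⟩
  + 1                      ∎)
  where
  open SetoidReasoning (≈-mod-setoid (+ n))
  negate : ∀ x a → - x * a ≡ + 1 - (+ 1 + x * a)
  negate = ℤ-Ring.solve-∀

*-cancelʳ-invertible : ∀ u → u * a ≈ + 1 [mod m ] → x * a ≈ y * a [mod m ] → x ≈ y [mod m ]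
*-cancelʳ-invertible {a} {m} {x} {y} u ua≈1 xa≈ya = begin
  x          ≈⟨ undo x ⟨
  x * a * u  ≈⟨ *-congʳ-mod u xa≈ya ⟩
  y * a * u  ≈⟨ undo y ⟩
  y          ∎
  where
  open SetoidReasoning (≈-mod-setoid m)
  undo : ∀ x → x * a * u ≈ x [mod m ]
  undo x = begin
    x * a * u    ≡⟨ ℤ.*-assoc x a u ⟩
    x * (a * u)  ≡⟨ cong (x *_) (ℤ.*-comm a u) ⟩
    x * (u * a)  ≈⟨ *-congˡ-mod x ua≈1 ⟩
    x * + 1      ≡⟨ ℤ.*-identityʳ x ⟩
    x            ∎

∣m⊖n∣<o : ∀ {m n o} → m < o → n < o → ∣ m ⊖ n ∣ < o
∣m⊖n∣<o {m} {n} {o} m<o n<o with ℕ.≤-total m n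
... | inj₁ m≤n = subst (_< o) (sym (ℤ.∣⊖∣-≤ m≤n)) (ℕ.≤-<-trans (ℕ.m∸n≤m n m) n<o)
... | inj₂ n≤m = subst (_< o) (sym (trans (ℤ.∣m⊖n∣≡∣n⊖m∣ m n) (ℤ.∣⊖∣-≤ n≤m)))
                   (ℕ.≤-<-trans (ℕ.m∸n≤m m n) m<o)

∣∧<⇒≡0 : ∀ {m n} → m ∣ n → n < m → n ≡ 0
∣∧<⇒≡0 {n = zero}  _   _   = refl
∣∧<⇒≡0 {n = suc _} m∣n n<m = contradiction m∣n (>⇒∤ n<m)

≈-mod-residue⇒≡ : ∀ {n p q} → p < n → q < n → + p ≈ + q [mod + n ] → p ≡ q
≈-mod-residue⇒≡ {n} {p} {q} p<n q<n (≈-mod n∣p-q) =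
  ℤ.+-injective (ℤ.i-j≡0⇒i≡j (+ p) (+ q) (trans p-q≡p⊖q (ℤ.∣i∣≡0⇒i≡0 ∣p⊖q∣≡0)))
  where
  p-q≡p⊖q : + p - + q ≡ p ⊖ q
  p-q≡p⊖q = ℤ.[+m]-[+n]≡m⊖n p q
  ∣p⊖q∣≡0 : ∣ p ⊖ q ∣ ≡ 0
  ∣p⊖q∣≡0 = ∣∧<⇒≡0 (subst (n ∣_) (cong ∣_∣ p-q≡p⊖q) n∣p-q) (∣m⊖n∣<o p<n q<n)

%ℕ-≈-mod : ∀ x n .{{_ : NonZero n}} → + (x %ℕ n) ≈ x [mod + n ]
%ℕ-≈-mod x n = begin
  + (x %ℕ n)                 ≈⟨ +-multiple-mod (+ (x %ℕ n)) (x /ℕ n) (+ n) ⟨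
  + (x %ℕ n) + x /ℕ n * + n  ≡⟨ a≡a%ℕn+[a/ℕn]*n x n ⟨
  x                          ∎
  where open SetoidReasoning (≈-mod-setoid (+ n))

invertible⇒unique-residue-solution :
  ∀ n .{{_ : NonZero n}} {a} u → u * a ≈ + 1 [mod + n ] → ∀ b →
  ∃[ ℓ ] ((+ 0 ≤ ℓ) × (ℓ <ℤ + n) × (ℓ * a ≡ b [mod + n ])
         × (∀ ℓ′ → + 0 ≤ ℓ′ → ℓ′ <ℤ + n → ℓ′ * a ≡ b [mod + n ] → ℓ′ ≡ ℓ))
invertible⇒unique-residue-solution n {a} u ua≈1 b =
  + r , +≤+ z≤n , +<+ r<n , ≡-mod ra≈b , unique
  where
  open SetoidReasoning (≈-mod-setoid (+ n))
  r : ℕ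
  r = (b * u) %ℕ n
  r<n : r < n
  r<n = n%ℕd<d (b * u) n
  ra≈b : + r * a ≈ b [mod + n ]
  ra≈b = begin
    + r * a      ≈⟨ *-congʳ-mod a (%ℕ-≈-mod (b * u) n) ⟩
    b * u * a    ≡⟨ ℤ.*-assoc b u a ⟩
    b * (u * a)  ≈⟨ *-congˡ-mod b ua≈1 ⟩
    b * + 1      ≡⟨ ℤ.*-identityʳ b ⟩
    b            ∎
  unique : ∀ ℓ′ → + 0 ≤ ℓ′ → ℓ′ <ℤ + n → ℓ′ * a ≡ b [mod + n ] → ℓ′ ≡ + r
  unique (+ p) (+≤+ _) (+<+ p<n) pa≡b = cong +_ (≈-mod-residue⇒≡ p<n r<n
    (*-cancelʳ-invertible u ua≈1 (≈-mod-trans (≈-mod pa≡b) (≈-mod-sym ra≈b))))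

unique-residue≡0⇔0-solves :
  ∀ {n} .{{_ : NonZero n}} {ℓ} a b → ℓ * a ≡ b [mod + n ] →
  (∀ ℓ′ → + 0 ≤ ℓ′ → ℓ′ <ℤ + n → ℓ′ * a ≡ b [mod + n ] → ℓ′ ≡ ℓ) →
  (ℓ ≡ + 0) ⇔ (+ 0 ≡ b [mod + n ])
unique-residue≡0⇔0-solves {n} a b ℓa≡b unique =
  mk⇔ (λ { refl → ℓa≡b }) (λ 0≡b → sym (unique (+ 0) (+≤+ z≤n) (+<+ (ℕ.>-nonZero⁻¹ n)) 0≡b))

σ₁ℕ σ₂ℕ σ₃ℕ : ℕ → ℕ → ℕ → ℕ
σ₁ℕ r₁ r₂ r₃ = r₁ ℕ.+ r₂ ℕ.+ r₃
σ₂ℕ r₁ r₂ r₃ = r₁ ℕ.* r₂ ℕ.+ r₁ ℕ.* r₃ ℕ.+ r₂ ℕ.* r₃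
σ₃ℕ r₁ r₂ r₃ = r₁ ℕ.* r₂ ℕ.* r₃

σ₁≡+σ₁ℕ : ∀ r₁ r₂ r₃ → σ₁ r₁ r₂ r₃ ≡ + σ₁ℕ r₁ r₂ r₃
σ₁≡+σ₁ℕ r₁ r₂ r₃ = sym (trans (ℤ.pos-+ (r₁ ℕ.+ r₂) r₃) (cong (_+ + r₃) (ℤ.pos-+ r₁ r₂)))

σ₂≡+σ₂ℕ : ∀ r₁ r₂ r₃ → σ₂ r₁ r₂ r₃ ≡ + σ₂ℕ r₁ r₂ r₃
σ₂≡+σ₂ℕ r₁ r₂ r₃ = sym (begin
  + (r₁ ℕ.* r₂ ℕ.+ r₁ ℕ.* r₃ ℕ.+ r₂ ℕ.* r₃)
    ≡⟨ ℤ.pos-+ (r₁ ℕ.* r₂ ℕ.+ r₁ ℕ.* r₃) (r₂ ℕ.* r₃) ⟩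
  + (r₁ ℕ.* r₂ ℕ.+ r₁ ℕ.* r₃) + + (r₂ ℕ.* r₃)
    ≡⟨ cong (_+ + (r₂ ℕ.* r₃)) (ℤ.pos-+ (r₁ ℕ.* r₂) (r₁ ℕ.* r₃)) ⟩
  + (r₁ ℕ.* r₂) + + (r₁ ℕ.* r₃) + + (r₂ ℕ.* r₃)
    ≡⟨ cong₂ _+_ (cong₂ _+_ (ℤ.pos-* r₁ r₂) (ℤ.pos-* r₁ r₃)) (ℤ.pos-* r₂ r₃) ⟩
  σ₂ r₁ r₂ r₃
    ∎)
  where open ≡-Reasoning

σ₃≡+σ₃ℕ : ∀ r₁ r₂ r₃ → σ₃ r₁ r₂ r₃ ≡ + σ₃ℕ r₁ r₂ r₃
σ₃≡+σ₃ℕ r₁ r₂ r₃ = sym (trans (ℤ.pos-* (r₁ ℕ.* r₂) r₃) (cong (_* + r₃) (ℤ.pos-* r₁ r₂)))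

coprime-* : ∀ {m n o} → Coprime m n → Coprime m o → Coprime m (n ℕ.* o)
coprime-* {m} {n} m⊥n m⊥o (i∣m , i∣no) = m⊥o (i∣m , coprime-divisor i⊥n i∣no)
  where
  i⊥n : Coprime _ n
  i⊥n (j∣i , j∣n) = m⊥n (∣-trans j∣i i∣m , j∣n)

coprime-*+ : ∀ {m n} k → Coprime m n → Coprime m (m ℕ.* k ℕ.+ n)
coprime-*+ k m⊥n (i∣m , i∣mk+n) = m⊥n (i∣m , ∣m+n∣m⇒∣n i∣mk+n (∣-trans i∣m (m∣m*n k)))

coprime-σ₂ℕ : ∀ {r₁ r₂ r₃} → Coprime r₁ r₂ → Coprime r₁ r₃ → Coprime r₁ (σ₂ℕ r₁ r₂ r₃)
coprime-σ₂ℕ {r₁} {r₂} {r₃} r₁⊥r₂ r₁⊥r₃ =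
  subst (Coprime r₁) (split r₁ r₂ r₃) (coprime-*+ (r₂ ℕ.+ r₃) (coprime-* r₁⊥r₂ r₁⊥r₃))
  where
  split : ∀ r₁ r₂ r₃ →
          r₁ ℕ.* (r₂ ℕ.+ r₃) ℕ.+ r₂ ℕ.* r₃ ≡ r₁ ℕ.* r₂ ℕ.+ r₁ ℕ.* r₃ ℕ.+ r₂ ℕ.* r₃
  split = ℕ-Ring.solve-∀

σ₂ℕ-swap : ∀ r₁ r₂ r₃ → σ₂ℕ r₂ r₁ r₃ ≡ σ₂ℕ r₁ r₂ r₃
σ₂ℕ-swap = swap
  where
  swap : ∀ r₁ r₂ r₃ →
         r₂ ℕ.* r₁ ℕ.+ r₂ ℕ.* r₃ ℕ.+ r₁ ℕ.* r₃ ≡ r₁ ℕ.* r₂ ℕ.+ r₁ ℕ.* r₃ ℕ.+ r₂ ℕ.* r₃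
  swap = ℕ-Ring.solve-∀

σ₂ℕ-rotate : ∀ r₁ r₂ r₃ → σ₂ℕ r₃ r₁ r₂ ≡ σ₂ℕ r₁ r₂ r₃
σ₂ℕ-rotate = rotate
  where
  rotate : ∀ r₁ r₂ r₃ →
           r₃ ℕ.* r₁ ℕ.+ r₃ ℕ.* r₂ ℕ.+ r₁ ℕ.* r₂ ≡ r₁ ℕ.* r₂ ℕ.+ r₁ ℕ.* r₃ ℕ.+ r₂ ℕ.* r₃
  rotate = ℕ-Ring.solve-∀

σ₂ℕ-coprime-σ₃ℕ : ∀ {r₁ r₂ r₃} → Coprime r₁ r₂ → Coprime r₁ r₃ → Coprime r₂ r₃ →
                  Coprime (σ₂ℕ r₁ r₂ r₃) (σ₃ℕ r₁ r₂ r₃)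
σ₂ℕ-coprime-σ₃ℕ {r₁} {r₂} {r₃} r₁⊥r₂ r₁⊥r₃ r₂⊥r₃ =
  coprime-* (coprime-* (Coprime.sym r₁⊥σ₂) (Coprime.sym r₂⊥σ₂)) (Coprime.sym r₃⊥σ₂)
  where
  r₁⊥σ₂ : Coprime r₁ (σ₂ℕ r₁ r₂ r₃)
  r₁⊥σ₂ = coprime-σ₂ℕ r₁⊥r₂ r₁⊥r₃
  r₂⊥σ₂ : Coprime r₂ (σ₂ℕ r₁ r₂ r₃)
  r₂⊥σ₂ = subst (Coprime r₂) (σ₂ℕ-swap r₁ r₂ r₃) (coprime-σ₂ℕ (Coprime.sym r₁⊥r₂) r₂⊥r₃)
  r₃⊥σ₂ : Coprime r₃ (σ₂ℕ r₁ r₂ r₃)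
  r₃⊥σ₂ = subst (Coprime r₃) (σ₂ℕ-rotate r₁ r₂ r₃)
            (coprime-σ₂ℕ (Coprime.sym r₁⊥r₃) (Coprime.sym r₂⊥r₃))

increasing-pair-*<3 : ∀ {p q} → 0 < p → p < q → p ℕ.* q < 3 → p ≡ 1 × q ≡ 2
increasing-pair-*<3 {1} {1} _ (s≤s ()) _
increasing-pair-*<3 {1} {2} _ _ _ = refl , refl
increasing-pair-*<3 {1} {suc (suc (suc _))} _ _ (s≤s (s≤s (s≤s ())))
increasing-pair-*<3 {suc (suc _)} {1} _ (s≤s ()) _
increasing-pair-*<3 {suc (suc _)} {suc (suc (suc _))} _ _ (s≤s (s≤s (s≤s ())))

+-<-3* : ∀ {p q r} → p < r → q < r → p ℕ.+ q ℕ.+ r < 3 ℕ.* r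
+-<-3* {p} {q} {r} p<r q<r = begin-strict
  p ℕ.+ q ℕ.+ r  <⟨ ℕ.+-monoˡ-< r (ℕ.+-mono-< p<r q<r) ⟩
  r ℕ.+ r ℕ.+ r  ≡⟨ thrice r ⟩
  3 ℕ.* r        ∎
  where
  open ≤-Reasoning
  thrice : ∀ r → r ℕ.+ r ℕ.+ r ≡ 3 ℕ.* r
  thrice = ℕ-Ring.solve-∀

increasing-triple-*≤+ : ∀ {r₁ r₂ r₃} → 0 < r₁ → r₁ < r₂ → r₂ < r₃ →
                        σ₃ℕ r₁ r₂ r₃ ℕ.≤ σ₁ℕ r₁ r₂ r₃ → r₁ ≡ 1 × r₂ ≡ 2 × r₃ ≡ 3
increasing-triple-*≤+ {r₁} {r₂} {r₃} 0<r₁ r₁<r₂ r₂<r₃ r₁r₂r₃≤r₁+r₂+r₃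
  with refl , refl ← increasing-pair-*<3 0<r₁ r₁<r₂ (ℕ.*-cancelʳ-< r₃ (r₁ ℕ.* r₂) 3
                       (ℕ.≤-<-trans r₁r₂r₃≤r₁+r₂+r₃ (+-<-3* (ℕ.<-trans r₁<r₂ r₂<r₃) r₂<r₃)))
  = refl , refl , ℕ.≤-antisym r₃≤3 r₂<r₃
  where
  r₃≤3 : r₃ ℕ.≤ 3
  r₃≤3 = ℕ.+-cancelʳ-≤ r₃ r₃ 3
    (subst (ℕ._≤ 3 ℕ.+ r₃) (cong (r₃ ℕ.+_) (ℕ.+-identityʳ r₃)) r₁r₂r₃≤r₁+r₂+r₃)

increasing-triple-*∣+⇔1,2,3 : ∀ {r₁ r₂ r₃} → 0 < r₁ → r₁ < r₂ → r₂ < r₃ →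
                              σ₃ℕ r₁ r₂ r₃ ∣ σ₁ℕ r₁ r₂ r₃ ⇔ (r₁ ≡ 1 × r₂ ≡ 2 × r₃ ≡ 3)
increasing-triple-*∣+⇔1,2,3 {suc _} 0<r₁ r₁<r₂ r₂<r₃ =
  mk⇔ (λ r₁r₂r₃∣r₁+r₂+r₃ → increasing-triple-*≤+ 0<r₁ r₁<r₂ r₂<r₃ (∣⇒≤ r₁r₂r₃∣r₁+r₂+r₃))
      (λ { (refl , refl , refl) → ℕ.∣-refl })

σ₃ℕ-nonZero : ∀ {r₁ r₂ r₃} → 0 < r₁ → r₁ < r₂ → r₂ < r₃ → NonZero (σ₃ℕ r₁ r₂ r₃)
σ₃ℕ-nonZero {suc _} {suc _} {suc _} _ _ _ = _

lemma7p3 : (r₁ r₂ r₃ : ℕ) → 0 < r₁ → r₁ < r₂ → r₂ < r₃ →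
           Coprime r₁ r₂ → Coprime r₁ r₃ → Coprime r₂ r₃ →
           (∃[ u ] (u * σ₂ r₁ r₂ r₃ ≡ + 1 [mod σ₃ r₁ r₂ r₃ ]))
           × (∃[ ℓ ] ((+ 0 ≤ ℓ) × (ℓ <ℤ σ₃ r₁ r₂ r₃)
                 × (ℓ * σ₂ r₁ r₂ r₃ ≡ - σ₁ r₁ r₂ r₃ [mod σ₃ r₁ r₂ r₃ ])
                 × (∀ ℓ′ → + 0 ≤ ℓ′ → ℓ′ <ℤ σ₃ r₁ r₂ r₃ →
                      ℓ′ * σ₂ r₁ r₂ r₃ ≡ - σ₁ r₁ r₂ r₃ [mod σ₃ r₁ r₂ r₃ ] → ℓ′ ≡ ℓ)
                 × ((ℓ ≡ + 0) ⇔ ((r₁ ≡ 1) × (r₂ ≡ 2) × (r₃ ≡ 3)))))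
lemma7p3 r₁ r₂ r₃ 0<r₁ r₁<r₂ r₂<r₃ r₁⊥r₂ r₁⊥r₃ r₂⊥r₃
  rewrite σ₁≡+σ₁ℕ r₁ r₂ r₃ | σ₂≡+σ₂ℕ r₁ r₂ r₃ | σ₃≡+σ₃ℕ r₁ r₂ r₃
  = let u , uσ₂≈1 = coprime⇒invertible (σ₂ℕ-coprime-σ₃ℕ r₁⊥r₂ r₁⊥r₃ r₂⊥r₃)
        ℓ , 0≤ℓ , ℓ<σ₃ , ℓσ₂≡-σ₁ , unique =
          invertible⇒unique-residue-solution (σ₃ℕ r₁ r₂ r₃) u uσ₂≈1 (- + σ₁ℕ r₁ r₂ r₃)
    in (u , ≡-mod uσ₂≈1)
     , ℓ , 0≤ℓ , ℓ<σ₃ , ℓσ₂≡-σ₁ , unique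
     , ⇔-trans (unique-residue≡0⇔0-solves (+ σ₂ℕ r₁ r₂ r₃) (- + σ₁ℕ r₁ r₂ r₃) ℓσ₂≡-σ₁ unique)
         (⇔-trans (0≡-b[mod]⇔∣ (+ σ₁ℕ r₁ r₂ r₃) (+ σ₃ℕ r₁ r₂ r₃))
           (increasing-triple-*∣+⇔1,2,3 0<r₁ r₁<r₂ r₂<r₃))
  where
  instance
    σ₃≢0 : NonZero (σ₃ℕ r₁ r₂ r₃)
    σ₃≢0 = σ₃ℕ-nonZero 0<r₁ r₁<r₂ r₂<r₃
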